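{- At every stage of the Algorithm described in the context, applied to $G_{P,h,C_P}$, we have $p(t_i)\ge p(b_i)-1$ for every $i\in\{1,2,\ldots,n\}$.
   Context: Let $P$ be a finite poset on a set $S_P$ of $n$ elements, $h: S_P\to\{1,\ldots,n\}$ a bijection, and $C_P\subseteq S_P\times S_P$ a set of pairs of distinct elements such that: (1) if $x<y$ in $P$ and $h(x)<h(y)$ then $(x,y)\in C_P$; (2) if $(x,y)\in C_P$ then $h(x)<h(y)$; (3) $C_P$ is transitive. The directed graph $G_{P,h,C_P}=(V,E)$ has $2n+2$ vertices: a source $b_0$, a sink $t_{n+1}$, and vertices $t_i,b_i$ for $1\le i\le n$. Its edges are: $(b_0,t_i)$, $(b_i,t_{n+1})$, $(t_i,b_i)$ for $1\le i\le n$, and $(b_i,t_j)$ whenever $(h^{ -1}(i),h^{ -1}(j))\in C_P$. Every edge has capacity $u=1$. The cost $c((v,w))$ is $-1$ if $w=t_{n+1}$, or if $v=b_i$, $w=t_j$ with $h^{ -1}(i)<h^{ -1}(j)$ in $P$ and $i<j$; all other edges have cost $0$. A flow is $f:E\to\mathbb{R}_{\ge 0}$ with $f\le u$ and conservation at every vertex other than $b_0,t_{n+1}$; its value is the total flow leaving $b_0$. A potential is $p:V\to\mathbb{R}$. Algorithm: (1) Initialize $f\equiv 0$ and $p(b_i)=p(t_i)=-i$ for all $i$. (2) Let $\bar E=\{(v,w):(v,w)\in E,\ p(w)-p(v)=c((v,w)),\ f((v,w))<u((v,w))\}\cup\{(w,v):(v,w)\in E,\ p(w)-p(v)=c((v,w)),\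 f((v,w))>0\}$, and let $X$ be the set of vertices reachable from $b_0$ via edges of $\bar E$. If $t_{n+1}\in X$ go to step 3, else go to step 4. (3) Choose a path from $b_0$ to $t_{n+1}$ in $\bar E$ and augment the flow by $1$ along it (increase on edges of $E$ traversed forwards, decrease on edges traversed backwards); go to step 5. (4) Increase by $1$ the potential of every vertex not in $X$; go to step 5. (5) If the flow has maximum possible value, stop; otherwise return to step 2. -}

module Defs where

open import Level using (0ℓ)
open import Data.Nat as ℕ using (ℕ; zero; suc)
open import Data.Fin as Fin using (Fin)
open import Data.Fin.Properties using () renaming (_≟_ to _≟ᶠ_)
open import Data.Integer as ℤ using (ℤ; +_; -_)
open import Data.Rational as ℚ using (ℚ; 0ℚ; 1ℚ)
open import Data.List using (List; []; _∷_; map; foldr; allFin)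
open import Data.List.Relation.Unary.Unique.Propositional using (Unique)
open import Data.Product using (_×_; _,_; ∃)
open import Data.Sum using (_⊎_)
open import Data.Unit using (⊤)
open import Data.Empty using (⊥)
open import Data.Bool using (Bool; true; false; if_then_else_; _∧_)
open import Relation.Nullary using (¬_; Dec; yes; no)
open import Relation.Nullary.Decidable using (⌊_⌋)
open import Relation.Binary.Core using (Rel)
open import Relation.Binary.Structures using (IsPartialOrder)
open import Relation.Binary.PropositionalEquality using (_≡_; _≢_; refl; cong)
open import Function.Bundles using (_↔_; Inverse)

-- The poset P lives on a set S with order _≤P_;
-- "x < y in P" means x ≤P y and x ≢ y.  h : S ↔ Fin n is the bijection
-- (Fin n stands for {1,…,n} via k ↦ toℕ k + 1; order preserved).

record Setup (n : ℕ) : Set₁ where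
  field
    S      : Set
    _≤P_   : Rel S 0ℓ
    isPO   : IsPartialOrder _≡_ _≤P_
    h      : S ↔ Fin n
    C      : Rel S 0ℓ
  _<P_ : Rel S 0ℓ
  x <P y = x ≤P y × x ≢ y
  hf : S → Fin n
  hf = Inverse.to h
  h⁻¹ : Fin n → S
  h⁻¹ = Inverse.from h
  field
    C-distinct : ∀ {x y} → C x y → x ≢ y
    C-cond1    : ∀ {x y} → x <P y → hf x Fin.< hf y → C x y
    C-cond2    : ∀ {x y} → C x y → hf x Fin.< hf y
    C-trans    : ∀ {x y z} → C x y → C y z → C x z

-- Vertices of G_{P,h,C_P}:  src = b_0, snk = t_{n+1}, t i, b i for i : Fin n
-- (t i, b i stand for t_{i+1}, b_{i+1}).

data Vtx (n : ℕ) : Set where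
  src snk : Vtx n
  t b     : Fin n → Vtx n

_≟V_ : ∀ {n} → (v w : Vtx n) → Dec (v ≡ w)
src ≟V src = yes refl
src ≟V snk = no λ ()
src ≟V t _ = no λ ()
src ≟V b _ = no λ ()
snk ≟V src = no λ ()
snk ≟V snk = yes refl
snk ≟V t _ = no λ ()
snk ≟V b _ = no λ ()
t _ ≟V src = no λ ()
t _ ≟V snk = no λ ()
t i ≟V t j with i ≟ᶠ j
... | yes refl = yes refl
... | no i≢j = no λ { refl → i≢j refl }
t _ ≟V b _ = no λ ()
b _ ≟V src = no λ ()
b _ ≟V snk = no λ ()
b _ ≟V t _ = no λ ()
b i ≟V b j with i ≟ᶠ j
... | yes refl = yes refl
... | no i≢j = no λ { refl → i≢j refl }

allVtx : (n : ℕ) → List (Vtx n)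
allVtx n = src ∷ snk ∷ map t (allFin n) Data.List.++ map b (allFin n)
  where import Data.List

-- Flows are rational-valued functions on ordered pairs of vertices
-- (required to vanish on non-edges); potentials are integer-valued.
Flow : ℕ → Set
Flow n = Vtx n → Vtx n → ℚ

Pot : ℕ → Set
Pot n = Vtx n → ℤ

sumℚ : List ℚ → ℚ
sumℚ = foldr ℚ._+_ 0ℚ

module Alg {n : ℕ} (I : Setup n) where
  open Setup I

  data Edge : Vtx n → Vtx n → Set where
    e-src : ∀ i → Edge src (t i)
    e-snk : ∀ i → Edge (b i) snk
    e-tb  : ∀ i → Edge (t i) (b i)
    e-bt  : ∀ i j → C (h⁻¹ i) (h⁻¹ j) → Edge (b i) (t j)

  -- the cost c(v,w) is -1 exactly when NegCost v w holds, 0 otherwise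
  NegCost : Vtx n → Vtx n → Set
  NegCost _     snk   = ⊤
  NegCost (b i) (t j) = (h⁻¹ i <P h⁻¹ j) × (i Fin.< j)
  NegCost _     _     = ⊥

  Tight : Pot n → Vtx n → Vtx n → Set
  Tight p v w = (NegCost v w → p w ℤ.- p v ≡ - + 1)
              × (¬ NegCost v w → p w ℤ.- p v ≡ + 0)

  outflow inflow : Flow n → Vtx n → ℚ
  outflow g v = sumℚ (map (λ w → g v w) (allVtx n))
  inflow  g v = sumℚ (map (λ u → g u v) (allVtx n))

  value : Flow n → ℚ
  value g = outflow g src

  record Feasible (g : Flow n) : Set where
    field
      nonneg   : ∀ v w → 0ℚ ℚ.≤ g v w
      capacity : ∀ v w → Edge v w → g v w ℚ.≤ 1ℚ
      off-edge : ∀ v w → ¬ Edge v w → g v w ≡ 0ℚ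
      conserve : ∀ v → v ≢ src → v ≢ snk → inflow g v ≡ outflow g v

  MaxValue : Flow n → Set
  MaxValue f = ∀ g → Feasible g → value g ℚ.≤ value f

  -- arcs of the residual graph: fwd v w traverses edge (v,w) from v to w,
  -- bwd v w traverses edge (v,w) backwards, from w to v.
  data Arc : Set where
    fwd bwd : Vtx n → Vtx n → Arc

  start end : Arc → Vtx n
  start (fwd v w) = v
  start (bwd v w) = w
  end   (fwd v w) = w
  end   (bwd v w) = v

  InĒ : Flow n → Pot n → Arc → Set
  InĒ f p (fwd v w) = Edge v w × Tight p v w × f v w ℚ.< 1ℚ
  InĒ f p (bwd v w) = Edge v w × Tight p v w × 0ℚ ℚ.< f v w

  data Reach (f : Flow n) (p : Pot n) : Vtx n → Set where
    here : Reach f p src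
    ext  : ∀ a → Reach f p (start a) → InĒ f p a → Reach f p (end a)

  data Walk (f : Flow n) (p : Pot n) : Vtx n → Vtx n → List Arc → Set where
    []  : ∀ {v} → Walk f p v v []
    _∷_ : ∀ {a w as} → InĒ f p a → Walk f p (end a) w as → Walk f p (start a) w (a ∷ as)

  Path : Flow n → Pot n → Vtx n → Vtx n → List Arc → Set
  Path f p v w as = Walk f p v w as × Unique (v ∷ map end as)

  bump : Arc → Flow n → Flow n
  bump (fwd x y) g v w =
    if ⌊ v ≟V x ⌋ ∧ ⌊ w ≟V y ⌋ then g v w ℚ.+ 1ℚ else g v w
  bump (bwd x y) g v w =
    if ⌊ v ≟V x ⌋ ∧ ⌊ w ≟V y ⌋ then g v w ℚ.- 1ℚ else g v w

  augment : List Arc → Flow n → Flow n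
  augment []       g = g
  augment (a ∷ as) g = bump a (augment as g)

  data Step (f : Flow n) (p : Pot n) : Flow n → Pot n → Set where
    step3 : Reach f p snk → ∀ as → Path f p src snk as
          → Step f p (augment as f) p
    step4 : ¬ Reach f p snk → (p' : Pot n)
          → (∀ v → Reach f p v → p' v ≡ p v)
          → (∀ v → ¬ Reach f p v → p' v ≡ p v ℤ.+ + 1)
          → Step f p f p'

  f₀ : Flow n
  f₀ _ _ = 0ℚ

  idx : Fin n → ℤ            -- Fin index k stands for k+1
  idx k = + suc (Fin.toℕ k)

  p₀ : Pot n
  p₀ src   = + 0
  p₀ snk   = - + suc n
  p₀ (t k) = - idx k
  p₀ (b k) = - idx k

  -- states after at least one pass through steps 2–4; a further pass is
  -- made only if step 5 did not stop (the flow is not of maximum value).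
  data Run : Flow n → Pot n → Set where
    first : ∀ {f p} → Step f₀ p₀ f p → Run f p
    next  : ∀ {f p f' p'} → Run f p → ¬ MaxValue f → Step f p f' p' → Run f' p'

  data Stage : Flow n → Pot n → Set where
    initial : Stage f₀ p₀
    running : ∀ {f p} → Run f p → Stage f p

-- The bound is one component of an invariant kept by both kinds of step.
-- The other components say that the flow is 0/1-valued and made of unit paths
-- through the edges t_i → b_i (b_i sends flow out, along a single edge, exactly
-- when t_i → b_i is saturated, and a saturated t_i → b_i not fed by b_0 is fed
-- by some b_j), that every empty edge satisfies p(w) − p(v) ≤ c(v,w), and that
-- the saturated edges out of each b_i are tight.  Augmenting along a simple
-- path of tight residual arcs preserves all of this.  Raising the potential
-- outside X can only break the bound at an i with t_i ∈ X, b_i ∉ X and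
-- p(t_i) = p(b_i) − 1.  Then t_i → b_i is saturated, t_i is reached from some
-- b_j ∈ X over a tight edge with (h⁻¹ j, h⁻¹ i) ∈ C_P, and since C_P is
-- transitive the edge from b_j to the flow successor w of b_i exists and is
-- tight too.  So w ∈ X, and then b_i ∈ X through the backward arc of (b_i, w).

module Submission where

open import Defs
open import Data.Nat using (ℕ)
open import Data.Fin using (Fin)
open import Data.Integer using (_≤_; _-_; +_)

import Data.Nat as ℕ
import Data.Nat.Properties as ℕP
import Data.Fin as Fin
import Data.Fin.Properties as FinP
open import Data.Integer as ℤ using (ℤ; 0ℤ; 1ℤ; -1ℤ; -_; _⊖_)
import Data.Integer.Properties as ℤP
open import Data.Integer.Tactic.RingSolver using (solve-∀)
open import Data.Rational as ℚ using (0ℚ; 1ℚ)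
import Data.Rational.Properties as ℚP
open import Data.List using (List; []; _∷_; map)
open import Data.List.Membership.Propositional using (_∈_; _∉_)
open import Data.List.Membership.Propositional.Properties using (∈-map⁺)
open import Data.List.Relation.Unary.Any using (here; there)
open import Data.List.Relation.Unary.All as All using (All)
open import Data.List.Relation.Unary.AllPairs using (_∷_)
open import Data.List.Relation.Unary.Unique.Propositional using (Unique)
open import Data.List.Relation.Unary.Unique.Propositional.Properties using (map⁻)
open import Data.Product using (∃; _×_; _,_; proj₁; proj₂)
open import Data.Sum using (_⊎_; inj₁; inj₂)
open import Data.Empty using (⊥; ⊥-elim)
open import Data.Unit using (tt)
open import Relation.Nullary using (¬_; Dec; yes; no; Stable)
open import Relation.Nullary.Decidable using (decidable-stable; ¬¬-excluded-middle; map′; _×-dec_)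
open import Relation.Nullary.Negation using (¬¬-map)
open import Relation.Binary.Definitions using (DecidableEquality)
open import Relation.Binary.PropositionalEquality
open import Relation.Binary.Structures using (IsPartialOrder)
open import Function.Bundles using (Inverse)

by-cases : ∀ (A : Set) {G : Set} → Dec G → (A → G) → (¬ A → G) → G
by-cases A G? k k′ = decidable-stable G? λ ¬g → ¬g (k′ (λ a → ¬g (k a)))

m<n⇒m⊖n≤-1 : ∀ {m n} → m ℕ.< n → m ⊖ n ≤ -1ℤ
m<n⇒m⊖n≤-1 m<n = subst (_≤ -1ℤ) (sym (ℤP.⊖-< m<n)) (-k≤-1 (ℕP.m<n⇒0<n∸m m<n))
  where
  -k≤-1 : ∀ {k} → 0 ℕ.< k → - + k ≤ -1ℤ
  -k≤-1 {ℕ.suc _} _ = ℤ.-≤- ℕ.z≤n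

≤∧≢⇒suc≤ : ∀ {i j} → i ≤ j → i ≢ j → ℤ.suc i ≤ j
≤∧≢⇒suc≤ i≤j i≢j = ℤP.i<j⇒suc[i]≤j (ℤP.≤∧≢⇒< i≤j i≢j)

[i+1]-[j+1]≡i-j : ∀ i j → (i ℤ.+ + 1) - (j ℤ.+ + 1) ≡ i - j
[i+1]-[j+1]≡i-j = solve-∀

[i+1]-j≡suc[i-j] : ∀ i j → (i ℤ.+ + 1) - j ≡ + 1 ℤ.+ (i - j)
[i+1]-j≡suc[i-j] = solve-∀

i-[j+1]≡pred[i-j] : ∀ i j → i - (j ℤ.+ + 1) ≡ - + 1 ℤ.+ (i - j)
i-[j+1]≡pred[i-j] = solve-∀

j-i≡-[i-j] : ∀ i j → j - i ≡ - (i - j)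
j-i≡-[i-j] = solve-∀

l-i≡[j-i]+[k-j]+[l-k] : ∀ i j k l → l - i ≡ (j - i) ℤ.+ (k - j) ℤ.+ (l - k)
l-i≡[j-i]+[k-j]+[l-k] = solve-∀

-1≤j-i⇒i-1≤j : ∀ i j → -1ℤ ≤ j - i → i - + 1 ≤ j
-1≤j-i⇒i-1≤j i j h = subst₂ _≤_ (lhs i) (rhs i j) (ℤP.+-monoˡ-≤ i h)
  where
  lhs : ∀ i → - + 1 ℤ.+ i ≡ i - + 1
  lhs = solve-∀
  rhs : ∀ i j → (j - i) ℤ.+ i ≡ j
  rhs = solve-∀

Δ : ∀ {n} → Pot n → Vtx n → Vtx n → ℤ
Δ p v w = p w - p v

Δ≡-1⇒reverse≡1 : ∀ {n} {p : Pot n} {v w} → Δ p v w ≡ -1ℤ → Δ p w v ≡ 1ℤ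
Δ≡-1⇒reverse≡1 {p = p} {v} {w} Δ≡-1 = trans (j-i≡-[i-j] (p w) (p v)) (cong -_ Δ≡-1)

module Costs {n : ℕ} (I : Setup n) where
  open Alg I

  WithinCost : Pot n → Vtx n → Vtx n → Set
  WithinCost p v w = Δ p v w ≤ 0ℤ × (NegCost v w → Δ p v w ≤ -1ℤ)

  withinCost-stable : ∀ {p v w} → Stable (WithinCost p v w)
  withinCost-stable {p} {v} {w} ¬¬wc =
      decidable-stable (Δ p v w ℤP.≤? 0ℤ) (¬¬-map proj₁ ¬¬wc)
    , λ c → decidable-stable (Δ p v w ℤP.≤? -1ℤ) (¬¬-map (λ wc → proj₂ wc c) ¬¬wc)

  ≤-1⇒withinCost : ∀ {p v w} → Δ p v w ≤ -1ℤ → WithinCost p v w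
  ≤-1⇒withinCost Δ≤-1 = ℤP.≤-trans Δ≤-1 ℤ.-≤+ , λ _ → Δ≤-1

  tight⇒withinCost : ∀ {p v w} → Tight p v w → WithinCost p v w
  tight⇒withinCost {p} {v} {w} (neg , nonneg) =
      by-cases (NegCost v w) (Δ p v w ℤP.≤? 0ℤ)
        (λ c → ℤP.≤-trans (ℤP.≤-reflexive (neg c)) ℤ.-≤+)
        (λ ¬c → ℤP.≤-reflexive (nonneg ¬c))
    , λ c → ℤP.≤-reflexive (neg c)

  tight⇒-1≤Δ : ∀ {p v w} → Tight p v w → -1ℤ ≤ Δ p v w
  tight⇒-1≤Δ {p} {v} {w} (neg , nonneg) =
    by-cases (NegCost v w) (-1ℤ ℤP.≤? Δ p v w)
      (λ c → ℤP.≤-reflexive (sym (neg c)))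
      (λ ¬c → ℤP.≤-trans ℤ.-≤+ (ℤP.≤-reflexive (sym (nonneg ¬c))))

  tight-cong : ∀ {p p′ v w} → Δ p′ v w ≡ Δ p v w → Tight p v w → Tight p′ v w
  tight-cong eq (neg , nonneg) = (λ c → trans eq (neg c)) , (λ ¬c → trans eq (nonneg ¬c))

  withinCost-lower : ∀ {p p′ v w} → Δ p′ v w ≤ Δ p v w → WithinCost p v w → WithinCost p′ v w
  withinCost-lower ≤Δ (≤0 , neg) = ℤP.≤-trans ≤Δ ≤0 , λ c → ℤP.≤-trans ≤Δ (neg c)

  withinCost-raise : ∀ {p p′ v w} → Δ p′ v w ≡ ℤ.suc (Δ p v w) → ¬ Tight p v w
                   → WithinCost p v w → WithinCost p′ v w
  withinCost-raise {p} {p′} {v} {w} eq ¬tight (≤0 , neg) =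
      subst (_≤ 0ℤ) (sym eq) (≤∧≢⇒suc≤ ≤0 Δ≢0)
    , λ c → subst (_≤ -1ℤ) (sym eq) (≤∧≢⇒suc≤ (neg c) λ Δ≡-1 → ¬tight ((λ _ → Δ≡-1) , λ ¬c → ⊥-elim (¬c c)))
    where
    0≰-1 : ¬ (0ℤ ≤ -1ℤ)
    0≰-1 ()
    Δ≢0 : Δ p v w ≢ 0ℤ
    Δ≢0 Δ≡0 = by-cases (NegCost v w) (no λ ())
      (λ c → 0≰-1 (subst (_≤ -1ℤ) Δ≡0 (neg c)))
      (λ ¬c → ¬tight ((λ c → ⊥-elim (¬c c)) , λ _ → Δ≡0))

  tight-shortcut : ∀ {p u x y w} → Tight p u x → Δ p x y ≡ 1ℤ → Tight p y w
                 → (NegCost u x → NegCost y w → NegCost u w)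
                 → WithinCost p u w → Tight p u w
  tight-shortcut {p} {u} {x} {y} {w} Tux Δxy≡1 Tyw negCost-trans (≤0 , neg) =
      (λ c → ℤP.≤-antisym (neg c) (detour (tight⇒-1≤Δ {p} Tux) (tight⇒-1≤Δ {p} Tyw)))
    , (λ ¬c → ℤP.≤-antisym ≤0 (0≤Δ ¬c))
    where
    detour : ∀ {k l} → k ≤ Δ p u x → l ≤ Δ p y w → k ℤ.+ 1ℤ ℤ.+ l ≤ Δ p u w
    detour k≤ l≤ = subst (_ ≤_) (sym Δuw≡) (ℤP.+-mono-≤ (ℤP.+-monoˡ-≤ 1ℤ k≤) l≤)
      where
      Δuw≡ : Δ p u w ≡ Δ p u x ℤ.+ 1ℤ ℤ.+ Δ p y w
      Δuw≡ = trans (l-i≡[j-i]+[k-j]+[l-k] (p u) (p x) (p y) (p w))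
                   (cong (λ d → Δ p u x ℤ.+ d ℤ.+ Δ p y w) Δxy≡1)
    0≤Δ : ¬ NegCost u w → 0ℤ ≤ Δ p u w
    0≤Δ ¬c = by-cases (NegCost u x) (0ℤ ℤP.≤? Δ p u w)
      (λ cux → by-cases (NegCost y w) (0ℤ ℤP.≤? Δ p u w)
        (λ cyw → ⊥-elim (¬c (negCost-trans cux cyw)))
        (λ ¬cyw → detour (tight⇒-1≤Δ {p} Tux) (ℤP.≤-reflexive (sym (proj₂ Tyw ¬cyw)))))
      (λ ¬cux → detour (ℤP.≤-reflexive (sym (proj₂ Tux ¬cux))) (tight⇒-1≤Δ {p} Tyw))

module Graph {n : ℕ} (I : Setup n) where
  open Setup I
  open Alg I

  edge-into-b : ∀ {x i} → Edge x (b i) → x ≡ t i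
  edge-into-b (e-tb _) = refl

  edge-from-t : ∀ {i y} → Edge (t i) y → y ≡ b i
  edge-from-t (e-tb _) = refl

  C⇒toℕ< : ∀ {i j} → C (h⁻¹ i) (h⁻¹ j) → Fin.toℕ i ℕ.< Fin.toℕ j
  C⇒toℕ< {i} {j} c = subst₂ (λ x y → Fin.toℕ x ℕ.< Fin.toℕ y)
    (Inverse.strictlyInverseˡ h i) (Inverse.strictlyInverseˡ h j) (C-cond2 c)

  shortcut-edge : ∀ {i j w} → C (h⁻¹ j) (h⁻¹ i) → Edge (b i) w → Edge (b j) w
  shortcut-edge _   (e-snk _)     = e-snk _
  shortcut-edge cji (e-bt _ k cik) = e-bt _ k (C-trans cji cik)

  shortcut-negCost : ∀ {i j w} → C (h⁻¹ j) (h⁻¹ i) → Edge (b i) w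
                   → NegCost (b j) (t i) → NegCost (b i) w → NegCost (b j) w
  shortcut-negCost _ (e-snk _) _ _ = tt
  shortcut-negCost cji (e-bt _ k cik) ((ji , _) , j<i) ((ik , _) , i<k) =
    (IsPartialOrder.trans isPO ji ik , C-distinct (C-trans cji cik)) , FinP.<-trans j<i i<k

Empty Full : ∀ {n} → Flow n → Vtx n → Vtx n → Set
Empty f x y = f x y ≡ 0ℚ
Full  f x y = f x y ≡ 1ℚ

module _ {n : ℕ} {f : Flow n} {x y : Vtx n} where

  empty⇒¬full : Empty f x y → ¬ Full f x y
  empty⇒¬full e F with trans (sym e) F
  ... | ()

  empty⇒<1 : Empty f x y → f x y ℚ.< 1ℚ
  empty⇒<1 e = subst (ℚ._< 1ℚ) (sym e) (ℚ.*<* (ℤ.+<+ (ℕ.s≤s ℕ.z≤n)))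

  full⇒>0 : Full f x y → 0ℚ ℚ.< f x y
  full⇒>0 F = subst (0ℚ ℚ.<_) (sym F) (ℚ.*<* (ℤ.+<+ (ℕ.s≤s ℕ.z≤n)))

  <1⇒empty : Empty f x y ⊎ Full f x y → f x y ℚ.< 1ℚ → Empty f x y
  <1⇒empty (inj₁ e) _  = e
  <1⇒empty (inj₂ F) <1 = ⊥-elim (ℚP.<-irrefl F <1)

  >0⇒full : Empty f x y ⊎ Full f x y → 0ℚ ℚ.< f x y → Full f x y
  >0⇒full (inj₁ e) >0 = ⊥-elim (ℚP.<-irrefl (sym e) >0)
  >0⇒full (inj₂ F) _  = F

module Augmenting {n : ℕ} (I : Setup n) where
  open Alg I

  _≟A_ : DecidableEquality Arc
  fwd v w ≟A fwd v′ w′ = map′ (λ { (refl , refl) → refl }) (λ { refl → refl , refl }) (v ≟V v′ ×-dec w ≟V w′)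
  bwd v w ≟A bwd v′ w′ = map′ (λ { (refl , refl) → refl }) (λ { refl → refl , refl }) (v ≟V v′ ×-dec w ≟V w′)
  fwd _ _ ≟A bwd _ _ = no λ ()
  bwd _ _ ≟A fwd _ _ = no λ ()

  open import Data.List.Membership.DecPropositional _≟A_ public using (_∈?_)

  module _ {x y : Vtx n} (g : Flow n) where

    bump-fwd : bump (fwd x y) g x y ≡ g x y ℚ.+ 1ℚ
    bump-fwd with x ≟V x | y ≟V y
    ... | yes _  | yes _  = refl
    ... | no x≢x | _      = ⊥-elim (x≢x refl)
    ... | yes _  | no y≢y = ⊥-elim (y≢y refl)

    bump-bwd : bump (bwd x y) g x y ≡ g x y ℚ.- 1ℚ
    bump-bwd with x ≟V x | y ≟V y
    ... | yes _  | yes _  = refl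
    ... | no x≢x | _      = ⊥-elim (x≢x refl)
    ... | yes _  | no y≢y = ⊥-elim (y≢y refl)

    bump-other : ∀ {a} → a ≢ fwd x y → a ≢ bwd x y → bump a g x y ≡ g x y
    bump-other {fwd x′ y′} ≢f _ with x ≟V x′ | y ≟V y′
    ... | yes refl | yes refl = ⊥-elim (≢f refl)
    ... | yes _    | no _     = refl
    ... | no _     | _        = refl
    bump-other {bwd x′ y′} _ ≢b with x ≟V x′ | y ≟V y′
    ... | yes refl | yes refl = ⊥-elim (≢b refl)
    ... | yes _    | no _     = refl
    ... | no _     | _        = refl

  module _ {x y : Vtx n} {g : Flow n} where

    augment-other : ∀ {as} → fwd x y ∉ as → bwd x y ∉ as → augment as g x y ≡ g x y
    augment-other {[]}     _   _   = refl
    augment-other {a ∷ as} ∉f ∉b =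
      trans (bump-other (augment as g) (λ eq → ∉f (here (sym eq))) (λ eq → ∉b (here (sym eq))))
            (augment-other (λ m → ∉f (there m)) (λ m → ∉b (there m)))

    augment-fwd : ∀ {as} → Unique as → fwd x y ∈ as → bwd x y ∉ as
                → augment as g x y ≡ g x y ℚ.+ 1ℚ
    augment-fwd {_ ∷ as} (a∉ ∷ _) (here refl) ∉b =
      trans (bump-fwd (augment as g)) (cong (ℚ._+ 1ℚ) (augment-other (λ m → All.lookup a∉ m refl) (λ m → ∉b (there m))))
    augment-fwd {_ ∷ as} (a∉ ∷ u) (there m) ∉b =
      trans (bump-other (augment as g) (All.lookup a∉ m) (λ eq → ∉b (here (sym eq))))
            (augment-fwd u m (λ m′ → ∉b (there m′)))

    augment-bwd : ∀ {as} → Unique as → bwd x y ∈ as → fwd x y ∉ as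
                → augment as g x y ≡ g x y ℚ.- 1ℚ
    augment-bwd {_ ∷ as} (a∉ ∷ _) (here refl) ∉f =
      trans (bump-bwd (augment as g)) (cong (ℚ._- 1ℚ) (augment-other (λ m → ∉f (there m)) (λ m → All.lookup a∉ m refl)))
    augment-bwd {_ ∷ as} (a∉ ∷ u) (there m) ∉f =
      trans (bump-other (augment as g) (λ eq → ∉f (here (sym eq))) (All.lookup a∉ m))
            (augment-bwd u m (λ m′ → ∉f (there m′)))

module Walks {n : ℕ} (I : Setup n) {f : Flow n} {p : Pot n} where
  open Alg I

  arc∈⇒Ē : ∀ {v w as a} → Walk f p v w as → a ∈ as → InĒ f p a
  arc∈⇒Ē (e ∷ _) (here refl) = e
  arc∈⇒Ē (_ ∷ W) (there m)   = arc∈⇒Ē W m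

  successor : ∀ {v w as a} → Walk f p v w as → a ∈ as → end a ≢ w
            → ∃ λ a′ → a′ ∈ as × start a′ ≡ end a
  successor {as = _ ∷ []}    (_ ∷ W) (here refl) a↛w = ⊥-elim (a↛w (empty-walk W))
    where
    empty-walk : ∀ {u w} → Walk f p u w [] → u ≡ w
    empty-walk [] = refl
  successor {as = _ ∷ _ ∷ _} (_ ∷ W) (here refl) _ = _ , there (here refl) , first-start W
    where
    first-start : ∀ {u w a as} → Walk f p u w (a ∷ as) → start a ≡ u
    first-start (_ ∷ _) = refl
  successor (_ ∷ W) (there m) a↛w with successor W m a↛w
  ... | a′ , m′ , eq = a′ , there m′ , eq

  predecessor : ∀ {v w as a} → Walk f p v w as → a ∈ as → start a ≢ v
              → ∃ λ a′ → a′ ∈ as × end a′ ≡ start a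
  predecessor (_ ∷ _) (here refl) v↛a = ⊥-elim (v↛a refl)
  predecessor {as = c ∷ _} {a} (_ ∷ W) (there m) _ with start a ≟V end c
  ... | yes eq = c , here refl , sym eq
  ... | no a≢c with predecessor W m a≢c
  ...   | a′ , m′ , eq = a′ , there m′ , eq

  start∈ : ∀ {v w as a} → Walk f p v w as → a ∈ as → start a ≡ v ⊎ start a ∈ map end as
  start∈ (_ ∷ _) (here refl) = inj₁ refl
  start∈ (_ ∷ W) (there m) with start∈ W m
  ... | inj₁ eq = inj₂ (here eq)
  ... | inj₂ m′ = inj₂ (there m′)

  module _ {v w as} (W : Walk f p v w as) (unique : Unique (v ∷ map end as)) where

    end≢source : ∀ {a} → a ∈ as → end a ≢ v
    end≢source m eq = go unique
      where
      go : Unique (v ∷ map end as) → ⊥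
      go (v∉ ∷ _) = All.lookup v∉ (∈-map⁺ end m) (sym eq)

    start-injective : ∀ {a a′} → a ∈ as → a′ ∈ as → start a ≡ start a′ → a ≡ a′
    start-injective = go W unique
      where
      go : ∀ {v w as a a′} → Walk f p v w as → Unique (v ∷ map end as)
         → a ∈ as → a′ ∈ as → start a ≡ start a′ → a ≡ a′
      go _       _          (here refl) (here refl) _  = refl
      go (_ ∷ W) (v∉ ∷ _)   (here refl) (there m′)  eq with start∈ W m′
      ... | inj₁ eq′ = ⊥-elim (All.lookup v∉ (here (trans eq eq′)) refl)
      ... | inj₂ m″  = ⊥-elim (All.lookup v∉ (there (subst (_∈ _) (sym eq) m″)) refl)
      go (_ ∷ W) (v∉ ∷ _)   (there m)   (here refl) eq with start∈ W m
      ... | inj₁ eq′ = ⊥-elim (All.lookup v∉ (here (trans (sym eq) eq′)) refl)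
      ... | inj₂ m″  = ⊥-elim (All.lookup v∉ (there (subst (_∈ _) eq m″)) refl)
      go (_ ∷ W) (_ ∷ u)    (there m)   (there m′)  eq = go W u m m′ eq

module Invariants {n : ℕ} (I : Setup n) where
  open Alg I
  open Costs I
  open Graph I

  record Invariant (f : Flow n) (p : Pot n) : Set where
    field
      zero-one          : ∀ x y → Empty f x y ⊎ Full f x y
      full-tb⇒full-out  : ∀ i → Full f (t i) (b i) → ∃ λ w → Edge (b i) w × Full f (b i) w
      full-out⇒full-tb  : ∀ i w → Edge (b i) w → Full f (b i) w → Full f (t i) (b i)
      full-out-unique   : ∀ i w w′ → Edge (b i) w → Edge (b i) w′ → Full f (b i) w → Full f (b i) w′ → w ≡ w′
      full-into-t       : ∀ i → Full f (t i) (b i) → Empty f src (t i)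
                        → ∃ λ j → Edge (b j) (t i) × Full f (b j) (t i)
      empty⇒withinCost  : ∀ v w → Edge v w → Empty f v w → WithinCost p v w
      full-out⇒tight    : ∀ i w → Edge (b i) w → Full f (b i) w → Tight p (b i) w
      Δ[b,t]≥-1         : ∀ i → -1ℤ ≤ Δ p (b i) (t i)

    out-of-b⇒withinCost : ∀ {i w} → Edge (b i) w → WithinCost p (b i) w
    out-of-b⇒withinCost {i} {w} E with zero-one (b i) w
    ... | inj₁ e = empty⇒withinCost (b i) w E e
    ... | inj₂ F = tight⇒withinCost {p} (full-out⇒tight i w E F)

    Δ[b,t]≡-1⇒full : ∀ {i} → Δ p (b i) (t i) ≡ -1ℤ → Full f (t i) (b i)
    Δ[b,t]≡-1⇒full {i} Δ≡-1 with zero-one (t i) (b i)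
    ... | inj₂ F = F
    ... | inj₁ e = ⊥-elim (1≰0 (subst (_≤ 0ℤ) (Δ≡-1⇒reverse≡1 {p = p} Δ≡-1)
                                      (proj₁ (empty⇒withinCost (t i) (b i) (e-tb i) e))))
      where
      1≰0 : ¬ (1ℤ ≤ 0ℤ)
      1≰0 (ℤ.+≤+ ())

  invariant₀ : Invariant f₀ p₀
  invariant₀ = record
    { zero-one         = λ _ _ → inj₁ refl
    ; full-tb⇒full-out = λ _ F → ⊥-elim (¬full₀ F)
    ; full-out⇒full-tb = λ _ _ _ F → ⊥-elim (¬full₀ F)
    ; full-out-unique  = λ _ _ _ _ _ F _ → ⊥-elim (¬full₀ F)
    ; full-into-t      = λ _ F _ → ⊥-elim (¬full₀ F)
    ; empty⇒withinCost = withinCost₀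
    ; full-out⇒tight   = λ _ _ _ F → ⊥-elim (¬full₀ F)
    ; Δ[b,t]≥-1        = λ i → subst (-1ℤ ≤_) (sym (ℤP.n⊖n≡0 (ℕ.suc (Fin.toℕ i)))) ℤ.-≤+
    }
    where
    ¬full₀ : 0ℚ ≢ 1ℚ
    ¬full₀ ()
    withinCost₀ : ∀ v w → Edge v w → Empty f₀ v w → WithinCost p₀ v w
    withinCost₀ _ _ (e-src _)    _ = ℤ.-≤+ , λ ()
    withinCost₀ _ _ (e-tb i)     _ = ℤP.≤-reflexive (ℤP.n⊖n≡0 (ℕ.suc (Fin.toℕ i))) , λ ()
    withinCost₀ _ _ (e-snk i)    _ = ≤-1⇒withinCost {p₀} {b i} {snk} (m<n⇒m⊖n≤-1 (ℕ.s≤s (FinP.toℕ<n i)))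
    withinCost₀ _ _ (e-bt i j c) _ = ≤-1⇒withinCost {p₀} {b i} {t j} (m<n⇒m⊖n≤-1 (ℕ.s≤s (C⇒toℕ< c)))

-- Step 3: augmentation

module AugmentStep {n : ℕ} (I : Setup n) {f : Flow n} {p : Pot n} {as : List (Alg.Arc I)}
                   (inv : Invariants.Invariant I f p)
                   (walk : Alg.Walk I f p src snk as)
                   (unique : Unique (src ∷ map (Alg.end I) as)) where
  open Alg I
  open Costs I
  open Graph I
  open Augmenting I
  open Walks I
  open Invariants I
  open Invariant inv

  f′ : Flow n
  f′ = augment as f

  pushable : ∀ {x y} → fwd x y ∈ as → Empty f x y
  pushable {x} {y} m = <1⇒empty {f = f} (zero-one x y) (proj₂ (proj₂ (arc∈⇒Ē walk m)))

  pullable : ∀ {x y} → bwd x y ∈ as → Full f x y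
  pullable {x} {y} m = >0⇒full {f = f} (zero-one x y) (proj₂ (proj₂ (arc∈⇒Ē walk m)))

  arcs-unique : Unique as
  arcs-unique = map⁻ (tail unique)
    where
    tail : ∀ {x xs} → Unique (x ∷ xs) → Unique xs
    tail (_ ∷ u) = u

  not-both : ∀ {x y} → fwd x y ∈ as → bwd x y ∉ as
  not-both ∈f ∈b = empty⇒¬full {f = f} (pushable ∈f) (pullable ∈b)

  data Touch (x y : Vtx n) : Set where
    untouched : fwd x y ∉ as → bwd x y ∉ as → f′ x y ≡ f x y → Touch x y
    pushed    : fwd x y ∈ as → Full f′ x y → Touch x y
    pulled    : bwd x y ∈ as → Empty f′ x y → Touch x y

  touch : ∀ x y → Touch x y
  touch x y with fwd x y ∈? as | bwd x y ∈? as
  ... | yes ∈f | yes ∈b = ⊥-elim (not-both ∈f ∈b)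
  ... | yes ∈f | no ∉b  = pushed ∈f
    (trans (augment-fwd {g = f} arcs-unique ∈f ∉b) (cong (ℚ._+ 1ℚ) (pushable ∈f)))
  ... | no ∉f  | yes ∈b = pulled ∈b
    (trans (augment-bwd {g = f} arcs-unique ∈b ∉f) (cong (ℚ._- 1ℚ) (pullable ∈b)))
  ... | no ∉f  | no ∉b  = untouched ∉f ∉b (augment-other {g = f} ∉f ∉b)

  pushed⇒full′ : ∀ {x y} → fwd x y ∈ as → Full f′ x y
  pushed⇒full′ {x} {y} ∈f with touch x y
  ... | untouched ∉f _ _ = ⊥-elim (∉f ∈f)
  ... | pushed _ F′      = F′
  ... | pulled ∈b _      = ⊥-elim (not-both ∈f ∈b)

  full-kept : ∀ {x y} → Full f x y → Full f′ x y ⊎ bwd x y ∈ as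
  full-kept {x} {y} F with touch x y
  ... | untouched _ _ eq = inj₁ (trans eq F)
  ... | pushed ∈f _      = ⊥-elim (empty⇒¬full {f = f} (pushable ∈f) F)
  ... | pulled ∈b _      = inj₂ ∈b

  full′-cases : ∀ {x y} → Full f′ x y → (Full f x y × bwd x y ∉ as) ⊎ fwd x y ∈ as
  full′-cases {x} {y} F′ with touch x y
  ... | untouched _ ∉b eq = inj₁ (trans (sym eq) F′ , ∉b)
  ... | pushed ∈f _       = inj₂ ∈f
  ... | pulled _ e′       = ⊥-elim (empty⇒¬full {f = f′} e′ F′)

  empty′-cases : ∀ {x y} → Empty f′ x y → (Empty f x y × fwd x y ∉ as) ⊎ bwd x y ∈ as
  empty′-cases {x} {y} e′ with touch x y
  ... | untouched ∉f _ eq = inj₁ (trans (sym eq) e′ , ∉f)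
  ... | pushed _ F′       = ⊥-elim (empty⇒¬full {f = f′} e′ F′)
  ... | pulled ∈b _       = inj₂ ∈b

  next-at-b : ∀ {a} i → a ∈ as → end a ≡ b i → bwd (t i) (b i) ∉ as
            → ∃ λ w → Edge (b i) w × Full f′ (b i) w
  next-at-b {a} i m a↦b ∉tb with successor walk m (λ a↦snk → b≢snk (trans (sym a↦b) a↦snk))
    where
    b≢snk : b i ≢ snk
    b≢snk ()
  ... | fwd _ _ , m′ , eq with trans eq a↦b
  ...   | refl = _ , proj₁ (arc∈⇒Ē walk m′) , pushed⇒full′ m′
  next-at-b i m a↦b ∉tb | bwd _ _ , m′ , eq with trans eq a↦b
  ...   | refl with edge-into-b (proj₁ (arc∈⇒Ē walk m′))
  ...     | refl = ⊥-elim (∉tb m′)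

  previous-at-b : ∀ {a} i → a ∈ as → start a ≡ b i
                → fwd (t i) (b i) ∈ as ⊎ ∃ λ y → bwd (b i) y ∈ as × Edge (b i) y
  previous-at-b {a} i m b↦a with predecessor walk m (λ src↦a → b≢src (trans (sym b↦a) src↦a))
    where
    b≢src : b i ≢ src
    b≢src ()
  ... | fwd _ _ , m′ , eq with trans eq b↦a
  ...   | refl with edge-into-b (proj₁ (arc∈⇒Ē walk m′))
  ...     | refl = inj₁ m′
  previous-at-b i m b↦a | bwd _ _ , m′ , eq with trans eq b↦a
  ...   | refl = inj₂ (_ , m′ , proj₁ (arc∈⇒Ē walk m′))

  previous-at-t : ∀ {a} i → a ∈ as → start a ≡ t i
                → fwd src (t i) ∈ as ⊎ bwd (t i) (b i) ∈ as ⊎ ∃ λ j → fwd (b j) (t i) ∈ as × Edge (b j) (t i)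
  previous-at-t {a} i m t↦a with predecessor walk m (λ src↦a → t≢src (trans (sym t↦a) src↦a))
    where
    t≢src : t i ≢ src
    t≢src ()
  ... | fwd _ _ , m′ , eq with trans eq t↦a | proj₁ (arc∈⇒Ē walk m′)
  ...   | refl | e-src _      = inj₁ m′
  ...   | refl | e-bt j _ cji = inj₂ (inj₂ (j , m′ , e-bt j i cji))
  previous-at-t i m t↦a | bwd _ _ , m′ , eq with trans eq t↦a
  ...   | refl with edge-from-t (proj₁ (arc∈⇒Ē walk m′))
  ...     | refl = inj₂ (inj₁ m′)

  pushed-out⇒full-out-pulled : ∀ {i w w′} → Edge (b i) w → Full f (b i) w
                             → fwd (b i) w′ ∈ as → bwd (b i) w ∈ as
  pushed-out⇒full-out-pulled {i} {w} E F ∈bw′ with previous-at-b i ∈bw′ refl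
  ... | inj₁ ∈tb = ⊥-elim (empty⇒¬full {f = f} (pushable ∈tb) (full-out⇒full-tb i w E F))
  ... | inj₂ (y , ∈by , E′) with full-out-unique i y w E′ E (pullable ∈by) F
  ...   | refl = ∈by

  zero-one′ : ∀ x y → Empty f′ x y ⊎ Full f′ x y
  zero-one′ x y with touch x y | zero-one x y
  ... | untouched _ _ eq | inj₁ e = inj₁ (trans eq e)
  ... | untouched _ _ eq | inj₂ F = inj₂ (trans eq F)
  ... | pushed _ F′      | _      = inj₂ F′
  ... | pulled _ e′      | _      = inj₁ e′

  full-tb⇒full-out′ : ∀ i → Full f′ (t i) (b i) → ∃ λ w → Edge (b i) w × Full f′ (b i) w
  full-tb⇒full-out′ i F′ with full′-cases F′
  ... | inj₂ ∈tb = next-at-b i ∈tb refl (not-both ∈tb)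
  ... | inj₁ (F , ∉tb) with full-tb⇒full-out i F
  ...   | w , E , Fw with full-kept Fw
  ...     | inj₁ F′w = w , E , F′w
  ...     | inj₂ ∈bw = next-at-b i ∈bw refl ∉tb

  full-out⇒full-tb′ : ∀ i w → Edge (b i) w → Full f′ (b i) w → Full f′ (t i) (b i)
  full-out⇒full-tb′ i w E F′ with full′-cases F′
  ... | inj₂ ∈bw with previous-at-b i ∈bw refl
  ...   | inj₁ ∈tb = pushed⇒full′ ∈tb
  ...   | inj₂ (y , ∈by , E′) with full-kept (full-out⇒full-tb i y E′ (pullable ∈by))
  ...     | inj₁ F′tb = F′tb
  ...     | inj₂ ∈bt with start-injective walk unique ∈bw ∈bt refl
  ...       | ()
  full-out⇒full-tb′ i w E F′ | inj₁ (F , ∉bw) with full-kept (full-out⇒full-tb i w E F)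
  ... | inj₁ F′tb = F′tb
  ... | inj₂ ∈bt with previous-at-b i ∈bt refl
  ...   | inj₁ ∈tb = ⊥-elim (not-both ∈tb ∈bt)
  ...   | inj₂ (y , ∈by , E′) with full-out-unique i y w E′ E (pullable ∈by) F
  ...     | refl = ⊥-elim (∉bw ∈by)

  full-out-unique′ : ∀ i w w′ → Edge (b i) w → Edge (b i) w′ → Full f′ (b i) w → Full f′ (b i) w′ → w ≡ w′
  full-out-unique′ i w w′ E E′ F F′ with full′-cases F | full′-cases F′
  ... | inj₁ (Fo , _)   | inj₁ (Fo′ , _)   = full-out-unique i w w′ E E′ Fo Fo′
  ... | inj₁ (Fo , ∉bw) | inj₂ ∈bw′         = ⊥-elim (∉bw (pushed-out⇒full-out-pulled E Fo ∈bw′))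
  ... | inj₂ ∈bw        | inj₁ (Fo′ , ∉bw′) = ⊥-elim (∉bw′ (pushed-out⇒full-out-pulled E′ Fo′ ∈bw))
  ... | inj₂ ∈bw        | inj₂ ∈bw′ with start-injective walk unique ∈bw ∈bw′ refl
  ...   | refl = refl

  full-into-t′ : ∀ i → Full f′ (t i) (b i) → Empty f′ src (t i)
               → ∃ λ j → Edge (b j) (t i) × Full f′ (b j) (t i)
  full-into-t′ i F′ e′ with full′-cases F′
  ... | inj₂ ∈tb with previous-at-t i ∈tb refl
  ...   | inj₁ ∈st                  = ⊥-elim (empty⇒¬full {f = f′} e′ (pushed⇒full′ ∈st))
  ...   | inj₂ (inj₁ ∈bt)           = ⊥-elim (not-both ∈tb ∈bt)
  ...   | inj₂ (inj₂ (j , ∈jt , E)) = j , E , pushed⇒full′ ∈jt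
  full-into-t′ i F′ e′ | inj₁ (F , ∉bt) with empty′-cases e′
  ... | inj₂ ∈ts = ⊥-elim (end≢source walk unique ∈ts refl)
  ... | inj₁ (e , ∉st) with full-into-t i F e
  ...   | j , E , Fj with full-kept Fj
  ...     | inj₁ F′j = j , E , F′j
  ...     | inj₂ ∈jt with previous-at-t i ∈jt refl
  ...       | inj₁ ∈st                  = ⊥-elim (∉st ∈st)
  ...       | inj₂ (inj₁ ∈bt)           = ⊥-elim (∉bt ∈bt)
  ...       | inj₂ (inj₂ (k , ∈kt , E′)) = k , E′ , pushed⇒full′ ∈kt

  empty⇒withinCost′ : ∀ v w → Edge v w → Empty f′ v w → WithinCost p v w
  empty⇒withinCost′ v w E e′ with empty′-cases e′
  ... | inj₁ (e , _) = empty⇒withinCost v w E e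
  ... | inj₂ ∈vw     = tight⇒withinCost {p} (proj₁ (proj₂ (arc∈⇒Ē walk ∈vw)))

  full-out⇒tight′ : ∀ i w → Edge (b i) w → Full f′ (b i) w → Tight p (b i) w
  full-out⇒tight′ i w E F′ with full′-cases F′
  ... | inj₁ (F , _) = full-out⇒tight i w E F
  ... | inj₂ ∈bw     = proj₁ (proj₂ (arc∈⇒Ē walk ∈bw))

  invariant′ : Invariant f′ p
  invariant′ = record
    { zero-one         = zero-one′
    ; full-tb⇒full-out = full-tb⇒full-out′
    ; full-out⇒full-tb = full-out⇒full-tb′
    ; full-out-unique  = full-out-unique′
    ; full-into-t      = full-into-t′
    ; empty⇒withinCost = empty⇒withinCost′
    ; full-out⇒tight   = full-out⇒tight′
    ; Δ[b,t]≥-1        = Δ[b,t]≥-1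
    }

-- Step 4: raising the potential outside X

module RaiseStep {n : ℕ} (I : Setup n) {f : Flow n} {p p′ : Pot n}
             (inv : Invariants.Invariant I f p)
             (snk∉X : ¬ Alg.Reach I f p snk)
             (in-X  : ∀ v → Alg.Reach I f p v → p′ v ≡ p v)
             (off-X : ∀ v → ¬ Alg.Reach I f p v → p′ v ≡ p v ℤ.+ + 1) where
  open Setup I
  open Alg I
  open Costs I
  open Graph I
  open Invariants I
  open Invariant inv

  X : Vtx n → Set
  X = Reach f p

  data Shift (v w : Vtx n) : Set where
    level : Δ p′ v w ≡ Δ p v w → Shift v w
    down  : ¬ X v → X w → Δ p′ v w ≡ ℤ.pred (Δ p v w) → Shift v w
    up    : X v → ¬ X w → Δ p′ v w ≡ ℤ.suc (Δ p v w) → Shift v w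

  -- Membership in X is not decidable here, so the case split is only available
  -- under double negation; every goal it is used for is stable.
  shift : ∀ v w → ¬ ¬ Shift v w
  shift v w ¬s = ¬¬-excluded-middle λ v? → ¬¬-excluded-middle λ w? → ¬s (classify v? w?)
    where
    classify : Dec (X v) → Dec (X w) → Shift v w
    classify (yes xv) (yes xw) = level (cong₂ _-_ (in-X w xw) (in-X v xv))
    classify (yes xv) (no ¬xw) = up xv ¬xw
      (trans (cong₂ _-_ (off-X w ¬xw) (in-X v xv)) ([i+1]-j≡suc[i-j] (p w) (p v)))
    classify (no ¬xv) (yes xw) = down ¬xv xw
      (trans (cong₂ _-_ (in-X w xw) (off-X v ¬xv)) (i-[j+1]≡pred[i-j] (p w) (p v)))
    classify (no ¬xv) (no ¬xw) = level
      (trans (cong₂ _-_ (off-X w ¬xw) (off-X v ¬xv)) ([i+1]-[j+1]≡i-j (p w) (p v)))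

  reached-by : ∀ {u} → X u → u ≡ src ⊎ ∃ λ a → X (start a) × InĒ f p a × end a ≡ u
  reached-by here         = inj₁ refl
  reached-by (ext a xa e) = inj₂ (a , xa , e , refl)

  full-out-of-reached-b : ∀ {j w} → X (b j) → Edge (b j) w → Full f (b j) w → X w
  full-out-of-reached-b {j} xb E F with reached-by xb
  ... | inj₁ ()
  ... | inj₂ (fwd _ _ , _ , (e-tb _ , _ , <1) , refl) =
    ⊥-elim (empty⇒¬full {f = f} (<1⇒empty {f = f} (zero-one _ _) <1) (full-out⇒full-tb j _ E F))
  ... | inj₂ (bwd _ _ , xy , (E′ , _ , >0) , refl)
    with full-out-unique j _ _ E′ E (>0⇒full {f = f} (zero-one _ _) >0) F
  ...   | refl = xy

  tight-out-of-reached-b : ∀ {j w} → X (b j) → Edge (b j) w → Tight p (b j) w → X w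
  tight-out-of-reached-b {j} {w} xb E T with zero-one (b j) w
  ... | inj₁ e = ext (fwd (b j) w) xb (E , T , empty⇒<1 {f = f} e)
  ... | inj₂ F = full-out-of-reached-b xb E F

  reached-t-via-b : ∀ {i} → ¬ X (b i) → X (t i) → Full f (t i) (b i)
                  → ∃ λ j → X (b j) × C (h⁻¹ j) (h⁻¹ i) × Tight p (b j) (t i)
  reached-t-via-b {i} ¬xb xt F with reached-by xt
  ... | inj₁ ()
  ... | inj₂ (fwd _ _ , xj , (e-bt j _ cji , T , _) , refl) = j , xj , cji , T
  ... | inj₂ (bwd _ _ , xb , (e-tb _ , _) , refl) = ⊥-elim (¬xb xb)
  ... | inj₂ (fwd _ _ , _ , (e-src _ , _ , <1) , refl)
    with full-into-t i F (<1⇒empty {f = f} (zero-one _ _) <1)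
  ...   | j , e-bt _ _ cji , Fj = j , ext (bwd (b j) (t i)) xt (e-bt j i cji , Tji , full⇒>0 {f = f} Fj) , cji , Tji
    where
    Tji : Tight p (b j) (t i)
    Tji = full-out⇒tight j (t i) (e-bt j i cji) Fj

  Δ[b,t]≡-1⇒b-reached : ∀ {i} → Δ p (b i) (t i) ≡ -1ℤ → X (t i) → ¬ ¬ X (b i)
  Δ[b,t]≡-1⇒b-reached {i} Δ≡-1 xt ¬xb
    with reached-t-via-b ¬xb xt (Δ[b,t]≡-1⇒full Δ≡-1) | full-tb⇒full-out i (Δ[b,t]≡-1⇒full Δ≡-1)
  ... | j , xj , cji , Tji | w , E , F = ¬xb (ext (bwd (b i) w) xw (E , Tiw , full⇒>0 {f = f} F))
    where
    Tiw : Tight p (b i) w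
    Tiw = full-out⇒tight i w E F
    Tjw : Tight p (b j) w
    Tjw = tight-shortcut {p} Tji (Δ≡-1⇒reverse≡1 {p = p} Δ≡-1) Tiw
            (shortcut-negCost cji E) (out-of-b⇒withinCost (shortcut-edge cji E))
    xw : X w
    xw = tight-out-of-reached-b xj (shortcut-edge cji E) Tjw

  empty⇒withinCost′ : ∀ v w → Edge v w → Empty f v w → WithinCost p′ v w
  empty⇒withinCost′ v w E e = withinCost-stable {p′} (¬¬-map within (shift v w))
    where
    wc : WithinCost p v w
    wc = empty⇒withinCost v w E e
    within : Shift v w → WithinCost p′ v w
    within (level eq)     = withinCost-lower {p} {p′} (ℤP.≤-reflexive eq) wc
    within (down _ _ eq)  = withinCost-lower {p} {p′}
                              (ℤP.≤-trans (ℤP.≤-reflexive eq) (ℤP.i≤j⇒pred[i]≤j ℤP.≤-refl)) wc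
    within (up xv ¬xw eq) = withinCost-raise {p} {p′} eq
                              (λ T → ¬xw (ext (fwd v w) xv (E , T , empty⇒<1 {f = f} e))) wc

  full-out⇒tight′ : ∀ i w → Edge (b i) w → Full f (b i) w → Tight p′ (b i) w
  full-out⇒tight′ i w E F = tight-cong {p} {p′}
    (decidable-stable (Δ p′ (b i) w ℤP.≟ Δ p (b i) w) (¬¬-map level-shift (shift (b i) w))) T
    where
    T : Tight p (b i) w
    T = full-out⇒tight i w E F
    level-shift : Shift (b i) w → Δ p′ (b i) w ≡ Δ p (b i) w
    level-shift (level eq)      = eq
    level-shift (down ¬xb xw _) = ⊥-elim (¬xb (ext (bwd (b i) w) xw (E , T , full⇒>0 {f = f} F)))
    level-shift (up xb ¬xw _)   = ⊥-elim (¬xw (full-out-of-reached-b xb E F))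

  Δ[b,t]≥-1′ : ∀ i → -1ℤ ≤ Δ p′ (b i) (t i)
  Δ[b,t]≥-1′ i = decidable-stable (-1ℤ ℤP.≤? Δ p′ (b i) (t i)) (¬¬-map bound (shift (b i) (t i)))
    where
    bound : Shift (b i) (t i) → -1ℤ ≤ Δ p′ (b i) (t i)
    bound (level eq)       = subst (-1ℤ ≤_) (sym eq) (Δ[b,t]≥-1 i)
    bound (up _ _ eq)      = subst (-1ℤ ≤_) (sym eq) (ℤP.≤-trans (Δ[b,t]≥-1 i) (ℤP.i≤suc[i] _))
    bound (down ¬xb xt eq) = subst (-1ℤ ≤_) (sym eq) (ℤP.i<j⇒i≤pred[j] (ℤP.≤∧≢⇒< (Δ[b,t]≥-1 i)
                               (λ -1≡Δ → Δ[b,t]≡-1⇒b-reached (sym -1≡Δ) xt ¬xb)))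

  invariant′ : Invariant f p′
  invariant′ = record
    { zero-one         = zero-one
    ; full-tb⇒full-out = full-tb⇒full-out
    ; full-out⇒full-tb = full-out⇒full-tb
    ; full-out-unique  = full-out-unique
    ; full-into-t      = full-into-t
    ; empty⇒withinCost = empty⇒withinCost′
    ; full-out⇒tight   = full-out⇒tight′
    ; Δ[b,t]≥-1        = Δ[b,t]≥-1′
    }

module _ {n : ℕ} (I : Setup n) where
  open Alg I
  open Invariants I

  invariant-step : ∀ {f p f′ p′} → Invariant f p → Step f p f′ p′ → Invariant f′ p′
  invariant-step inv (step3 _ _ (walk , unique)) = AugmentStep.invariant′ I inv walk unique
  invariant-step inv (step4 snk∉X _ in-X off-X) = RaiseStep.invariant′ I inv snk∉X in-X off-X

  invariant-run : ∀ {f p} → Run f p → Invariant f p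
  invariant-run (first s)    = invariant-step invariant₀ s
  invariant-run (next r _ s) = invariant-step (invariant-run r) s

  invariant : ∀ {f p} → Stage f p → Invariant f p
  invariant initial     = invariant₀
  invariant (running r) = invariant-run r

lemma4p2 : ∀ {n : ℕ} (I : Setup n) {f : Flow n} {p : Pot n}
           → Alg.Stage I f p
           → ∀ (i : Fin n) → p (Vtx.b i) - + 1 ≤ p (Vtx.t i)
lemma4p2 I {p = p} stage i =
  -1≤j-i⇒i-1≤j (p (Vtx.b i)) (p (Vtx.t i)) (Invariants.Invariant.Δ[b,t]≥-1 (invariant I stage) i)
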